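{- There is an algorithm which, given a substitution $\varphi$ on a finite alphabet $A$ extending over a letter $a_1$, a morphism $h\colon A^*\to B^*$ and a nonempty word $u\in B^*$, decides whether $W=h(\varphi^{\infty}(a_1))$ is ultimately periodic with period $u$, i.e. whether all words of length $|u|$ that occur infinitely many times in $W$ are cyclic shifts of $u$.
   Context: A substitution is a morphism $\varphi\colon A^*\to A^*$. It extends over $a_1$ if $\varphi(a_1)=a_1v$ with $\varphi^k(v)\neq\varepsilon$ for all $k\in\mathbb N$; then $\varphi^{\infty}(a_1)=a_1v\varphi(v)\varphi^2(v)\cdots$, and $h(\varphi^{\infty}(a_1))$ is obtained by applying $h$ letter by letter. -}

module Defs where

open import Data.Nat using (ℕ; zero; suc; _≥_)
open import Data.Fin using (Fin)
open import Data.List using (List; []; _∷_; _++_; length; concatMap)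
open import Data.Product using (Σ; ∃; _×_)
open import Relation.Binary.PropositionalEquality using (_≡_; _≢_)

morph : {n m : ℕ} → (Fin n → List (Fin m)) → List (Fin n) → List (Fin m)
morph f w = concatMap f w

iter : {n : ℕ} → (Fin n → List (Fin n)) → ℕ → List (Fin n) → List (Fin n)
iter φ zero    w = w
iter φ (suc k) w = morph φ (iter φ k w)

ExtendsOver : {n : ℕ} → (Fin n → List (Fin n)) → Fin n → Set
ExtendsOver {n} φ a₁ =
  Σ (List (Fin n)) λ v → (φ a₁ ≡ a₁ ∷ v) × (∀ k → iter φ k v ≢ [])

OccursAt : {m : ℕ} → List (Fin m) → ℕ → List (Fin m) → Set
OccursAt {m} w i z =
  Σ (List (Fin m)) λ x → Σ (List (Fin m)) λ y → (z ≡ x ++ w ++ y) × (length x ≡ i)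

-- Since φ(a₁) = a₁v, the words
-- h(φ^k(a₁)) are increasing prefixes of W whose union is W, so an occurrence in W
-- is exactly an occurrence in some h(φ^k(a₁)).
OccursAtFixpointImage : {n m : ℕ} → (Fin n → List (Fin n)) → Fin n →
  (Fin n → List (Fin m)) → List (Fin m) → ℕ → Set
OccursAtFixpointImage φ a₁ h w i =
  ∃ λ k → OccursAt w i (morph h (iter φ k (a₁ ∷ [])))

OccursInfinitelyOften : {n m : ℕ} → (Fin n → List (Fin n)) → Fin n →
  (Fin n → List (Fin m)) → List (Fin m) → Set
OccursInfinitelyOften φ a₁ h w =
  ∀ N → ∃ λ i → (i ≥ N) × OccursAtFixpointImage φ a₁ h w i

CyclicShift : {m : ℕ} → List (Fin m) → List (Fin m) → Set
CyclicShift {m} w u =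
  Σ (List (Fin m)) λ x → Σ (List (Fin m)) λ y → (u ≡ x ++ y) × (w ≡ y ++ x)

UltPeriodicWith : {n m : ℕ} → (Fin n → List (Fin n)) → Fin n →
  (Fin n → List (Fin m)) → List (Fin m) → Set
UltPeriodicWith {n} {m} φ a₁ h u =
  (w : List (Fin m)) → length w ≡ length u →
  OccursInfinitelyOften φ a₁ h w → CyclicShift w u

module Submission where

-- A word w occurs infinitely often in W = h(φ^∞(a₁)) iff for every k it is a factor of
-- some h(φ^k(v) φ^(k+1)(v) ⋯ φ^(k+j-1)(v)).  Whether a word contains w, and its first and
-- last |w| letters, are determined by the same data for the two halves of any split of it;
-- this "sketch" ranges over a finite set.  The vectors of sketches of h(φ^k(a)), a ∈ A,
-- therefore form the orbit of a map on a finite set, as do the pairs (sketch of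
-- h(φ^k(v) ⋯ φ^(k+j-1)(v)), vector at level k+j) for fixed k.  A predicate is decidable on
-- the whole orbit of a map on a finite set because the orbit is already exhausted by its
-- first (size of the set) + 1 points.

open import Defs
import Algebra.Solver.Monoid as MonoidSolver
open import Data.Bool using (Bool; true; false; T; _∨_)
open import Data.Fin as Fin using (Fin; toℕ)
open import Data.Fin.Properties using (pigeonhole; toℕ≤pred[n]) renaming (_≟_ to _≟ᶠ_)
open import Data.List using (List; []; _∷_; _++_; length; take; drop; reverse; foldr; allFin; cartesianProduct; cartesianProductWith)
open import Data.List.Properties using (++-monoid; length-++; length-++-≤ˡ; length-++-≤ʳ; length-take; length-reverse; reverse-++; reverse-involutive; take-take; take-[]; take++drop≡id; ∷-injective; concatMap-++; ++-identityʳ; ++-assoc; ≡-dec)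
open import Data.List.Membership.Propositional using (_∈_)
open import Data.List.Membership.Propositional.Properties using (∈-allFin; ∈-cartesianProduct⁺; ∈-cartesianProductWith⁺)
open import Data.List.Membership.Setoid.Properties using (index-injective)
open import Data.List.Relation.Binary.Infix.Heterogeneous using (Infix; MkView; toView; fromView)
open import Data.List.Relation.Binary.Infix.Heterogeneous.Properties using (infix?)
open import Data.List.Relation.Binary.Pointwise using (Pointwise-≡⇒≡; ≡⇒Pointwise-≡)
import Data.List.Relation.Unary.All as All
open import Data.List.Relation.Unary.Any using (here; there; index)
open import Data.Nat using (ℕ; zero; suc; _+_; _∸_; _⊓_; _≤_; _<_; _≥_; _≟_; _<?_; z≤n; s≤s)
open import Data.Nat.Induction using (<-rec)
open import Data.Nat.Properties using (≤-refl; ≤-reflexive; ≤-trans; m≤m+n; m≤n⇒m⊓n≡m; m⊓n≤m; m∸n+n≡m; m+1+n≰m; +-monoʳ-<; +-comm; +-suc; +-identityʳ; +-assoc; ≮⇒≥; n≤1+n; n<1+n; m<m+n; anyUpTo?; allUpTo?; module ≤-Reasoning)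
open import Data.Product using (∃; ∃₂; _×_; _,_; proj₁)
open import Data.Sum using (_⊎_; inj₁; inj₂; [_,_])
open import Data.Vec as Vec using (Vec; lookup; tabulate)
open import Data.Vec.Properties using (lookup∘tabulate; tabulate-cong)
open import Function using (_∘_; _⇔_; mk⇔; Equivalence)
import Function.Endo.Propositional as Endo
open import Relation.Binary.Definitions using (DecidableEquality)
open import Relation.Binary.PropositionalEquality using (_≡_; _≢_; refl; sym; trans; cong; cong₂; cong-app; subst; setoid; module ≡-Reasoning)
open import Relation.Nullary using (Dec; yes; no; does; contradiction)
open import Relation.Nullary.Decidable using (map′; does-⇔; isYes; isYes≗does; toWitness; fromWitness; _⊎-dec_; _→-dec_; T?)

_^_ : {A : Set} → (A → A) → ℕ → A → A
_^_ {A} = Endo._^_ A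

^-+ : {A : Set} (f : A → A) (t a : ℕ) (x : A) → (f ^ (t + a)) x ≡ (f ^ t) ((f ^ a) x)
^-+ {A} f t a = cong-app (Endo.^-homo A f t a)

module _ {A : Set} where

  open MonoidSolver (++-monoid A) using (solve; _⊕_; _⊜_)

  ++-≡-++ : (a b x y : List A) → a ++ b ≡ x ++ y →
    (∃ λ d → x ≡ a ++ d × b ≡ d ++ y) ⊎ (∃ λ d → a ≡ x ++ d × y ≡ d ++ b)
  ++-≡-++ []      b x        y eq = inj₁ (x , refl , eq)
  ++-≡-++ (c ∷ a) b []       y eq = inj₂ (c ∷ a , refl , sym eq)
  ++-≡-++ (c ∷ a) b (c′ ∷ x) y eq with refl , eq′ ← ∷-injective eq with ++-≡-++ a b x y eq′
  ... | inj₁ (d , x≡ , b≡) = inj₁ (d , cong (c ∷_) x≡ , b≡)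
  ... | inj₂ (d , a≡ , y≡) = inj₂ (d , cong (c ∷_) a≡ , y≡)

  ++-≡-++-≤ : (a b x y : List A) → a ++ b ≡ x ++ y → length x ≤ length a →
    ∃ λ d → y ≡ d ++ b
  ++-≡-++-≤ a b x y eq x≤a with ++-≡-++ a b x y eq
  ... | inj₂ (d , _ , y≡) = d , y≡
  ... | inj₁ ([] , _ , b≡) = [] , sym b≡
  ... | inj₁ (_ ∷ d , refl , _) =
    contradiction (subst (_≤ length a) (length-++ a) x≤a) (m+1+n≰m (length a))

  take-++-take : ∀ {k l l′} (x y : List A) → k ≤ l → k ≤ l′ →
    take k (x ++ y) ≡ take k (take l x ++ take l′ y)
  take-++-take {k} {l} {l′} [] y _ k≤l′ = sym (begin
    take k (take l [] ++ take l′ y) ≡⟨ cong (λ t → take k (t ++ take l′ y)) (take-[] l) ⟩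
    take k (take l′ y)              ≡⟨ take-take k l′ y ⟩
    take (k ⊓ l′) y                 ≡⟨ cong (λ i → take i y) (m≤n⇒m⊓n≡m k≤l′) ⟩
    take k y                        ∎)
    where open ≡-Reasoning
  take-++-take {zero}          (c ∷ x) y _         _    = refl
  take-++-take {suc k} {suc l} (c ∷ x) y (s≤s k≤l) 1+k≤l′ =
    cong (c ∷_) (take-++-take x y k≤l (≤-trans (n≤1+n k) 1+k≤l′))

  take-++-≤ : ∀ {k} (x y : List A) → length x ≤ k → ∃ λ r → take k (x ++ y) ≡ x ++ r
  take-++-≤ {k} [] y _ = take k y , refl
  take-++-≤ {suc k} (c ∷ x) y (s≤s x≤k) with r , eq ← take-++-≤ x y x≤k = r , cong (c ∷_) eq

  length-take-≤ : ∀ k (z : List A) → length (take k z) ≤ k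
  length-take-≤ k z = subst (_≤ k) (sym (length-take k z)) (m⊓n≤m k (length z))

  takeLast : ℕ → List A → List A
  takeLast k z = reverse (take k (reverse z))

  takeLast-++-≤ : ∀ {k} (y x : List A) → length x ≤ k → ∃ λ r → takeLast k (y ++ x) ≡ r ++ x
  takeLast-++-≤ {k} y x x≤k
    with r , eq ← take-++-≤ (reverse x) (reverse y) (subst (_≤ k) (sym (length-reverse x)) x≤k) =
    reverse r , (begin
      reverse (take k (reverse (y ++ x)))       ≡⟨ cong (reverse ∘ take k) (reverse-++ y x) ⟩
      reverse (take k (reverse x ++ reverse y)) ≡⟨ cong reverse eq ⟩
      reverse (reverse x ++ r)                  ≡⟨ reverse-++ (reverse x) r ⟩
      reverse r ++ reverse (reverse x)          ≡⟨ cong (reverse r ++_) (reverse-involutive x) ⟩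
      reverse r ++ x                            ∎)
    where open ≡-Reasoning

  takeLast-suffix : ∀ k (z : List A) → ∃ λ r → z ≡ r ++ takeLast k z
  takeLast-suffix k z = reverse (drop k (reverse z)) , (begin
      z                                                     ≡⟨ sym (reverse-involutive z) ⟩
      reverse (reverse z)                                   ≡⟨ cong reverse (sym (take++drop≡id k (reverse z))) ⟩
      reverse (take k (reverse z) ++ drop k (reverse z))    ≡⟨ reverse-++ (take k (reverse z)) _ ⟩
      reverse (drop k (reverse z)) ++ takeLast k z          ∎)
    where open ≡-Reasoning

  ≢[]⇒0<length : ∀ {z : List A} → z ≢ [] → 0 < length z
  ≢[]⇒0<length {[]}    z≢[] = contradiction refl z≢[]
  ≢[]⇒0<length {_ ∷ _} _    = s≤s z≤n

  take-length-++ : (x y : List A) → take (length x) (x ++ y) ≡ x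
  take-length-++ []      y = refl
  take-length-++ (c ∷ x) y = cong (c ∷_) (take-length-++ x y)

  drop-length-++ : (x y : List A) → drop (length x) (x ++ y) ≡ y
  drop-length-++ []      y = refl
  drop-length-++ (c ∷ x) y = drop-length-++ x y

  infix 4 _⊑_
  _⊑_ : List A → List A → Set
  w ⊑ z = ∃₂ λ a c → z ≡ a ++ w ++ c

  ⊑-trans : ∀ {u w z} → u ⊑ w → w ⊑ z → u ⊑ z
  ⊑-trans {u} (a , c , refl) (a′ , c′ , refl) = a′ ++ a , c ++ c′ ,
    solve 5 (λ a u c a′ c′ → a′ ⊕ (a ⊕ u ⊕ c) ⊕ c′ ⊜ (a′ ⊕ a) ⊕ u ⊕ (c ⊕ c′)) refl a u c a′ c′

  ⊑-++⁺ˡ : ∀ {w x} y → w ⊑ x → w ⊑ x ++ y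
  ⊑-++⁺ˡ y w⊑x = ⊑-trans w⊑x ([] , y , refl)

  ⊑-++⁺ʳ : ∀ {w y} x → w ⊑ y → w ⊑ x ++ y
  ⊑-++⁺ʳ {y = y} x w⊑y = ⊑-trans w⊑y (x , [] , cong (x ++_) (sym (++-identityʳ y)))

  takeLast-++-take-⊑ : ∀ k (x y : List A) → takeLast k x ++ take k y ⊑ x ++ y
  takeLast-++-take-⊑ k x y with r , x≡ ← takeLast-suffix k x = r , drop k y , (begin
      x ++ y                                         ≡⟨ cong₂ _++_ x≡ (sym (take++drop≡id k y)) ⟩
      (r ++ takeLast k x) ++ take k y ++ drop k y   ≡⟨ solve 4 (λ r s t d → (r ⊕ s) ⊕ t ⊕ d ⊜ r ⊕ (s ⊕ t) ⊕ d) refl r _ _ _ ⟩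
      r ++ (takeLast k x ++ take k y) ++ drop k y   ∎)
    where open ≡-Reasoning

  ⊑-straddle : ∀ {k} (a d d′ c : List A) → length (d ++ d′) ≤ k →
    d ++ d′ ⊑ takeLast k (a ++ d) ++ take k (d′ ++ c)
  ⊑-straddle {k} a d d′ c dd′≤k
    with r , ≡r++d ← takeLast-++-≤ a d (≤-trans (length-++-≤ˡ d) dd′≤k)
       | r′ , ≡d′++r′ ← take-++-≤ d′ c (≤-trans (length-++-≤ʳ d′ {d}) dd′≤k) =
    r , r′ , (begin
      takeLast k (a ++ d) ++ take k (d′ ++ c) ≡⟨ cong₂ _++_ ≡r++d ≡d′++r′ ⟩
      (r ++ d) ++ d′ ++ r′                    ≡⟨ solve 4 (λ r d d′ r′ → (r ⊕ d) ⊕ d′ ⊕ r′ ⊜ r ⊕ (d ⊕ d′) ⊕ r′) refl r d d′ r′ ⟩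
      r ++ (d ++ d′) ++ r′                    ∎)
    where open ≡-Reasoning

  ⊑-++⁻ : ∀ {k w} x y → length w ≤ k → w ⊑ x ++ y →
    w ⊑ x ⊎ w ⊑ y ⊎ w ⊑ takeLast k x ++ take k y
  ⊑-++⁻ {w = w} x y w≤k (a , c , eq) with ++-≡-++ a (w ++ c) x y (sym eq)
  ... | inj₂ (d , _ , y≡) = inj₂ (inj₁ (d , c , y≡))
  ... | inj₁ (d , refl , wc≡dy) with ++-≡-++ w c d y wc≡dy
  ...   | inj₁ (d′ , refl , _) = inj₁ (a , d′ , solve 3 (λ a w d′ → a ⊕ (w ⊕ d′) ⊜ a ⊕ w ⊕ d′) refl a w d′)
  ...   | inj₂ (d′ , refl , refl) = inj₂ (inj₂ (⊑-straddle a d d′ c w≤k))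

  ⊑-++⁺ : ∀ k {w} x y → w ⊑ x ⊎ w ⊑ y ⊎ w ⊑ takeLast k x ++ take k y → w ⊑ x ++ y
  ⊑-++⁺ k x y = [ ⊑-++⁺ˡ y , [ ⊑-++⁺ʳ x , (λ p → ⊑-trans p (takeLast-++-take-⊑ k x y)) ] ]

module Factor {A : Set} (_≟ᴬ_ : DecidableEquality A) where

  private
    Infix⇒⊑ : ∀ {w z : List A} → Infix _≡_ w z → w ⊑ z
    Infix⇒⊑ w≼z with MkView a w≋ c ← toView w≼z = a , c , cong (λ t → a ++ t ++ c) (sym (Pointwise-≡⇒≡ w≋))

    ⊑⇒Infix : ∀ {w z : List A} → w ⊑ z → Infix _≡_ w z
    ⊑⇒Infix (a , c , refl) = fromView (MkView a (≡⇒Pointwise-≡ refl) c)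

  infix 4 _⊑?_
  _⊑?_ : (w z : List A) → Dec (w ⊑ z)
  w ⊑? z = map′ Infix⇒⊑ ⊑⇒Infix (infix? _≟ᴬ_ w z)

  ⊑?-++ : ∀ k {w} x y → length w ≤ k →
    isYes (w ⊑? x ++ y) ≡ isYes (w ⊑? x) ∨ isYes (w ⊑? y) ∨ isYes (w ⊑? takeLast k x ++ take k y)
  ⊑?-++ k {w} x y w≤k = begin
    isYes (w ⊑? x ++ y)
      ≡⟨ isYes≗does (w ⊑? x ++ y) ⟩
    does (w ⊑? x ++ y)
      ≡⟨ does-⇔ (mk⇔ (⊑-++⁻ x y w≤k) (⊑-++⁺ k x y)) (w ⊑? x ++ y) (w ⊑? x ⊎-dec w ⊑? y ⊎-dec w ⊑? b) ⟩
    does (w ⊑? x) ∨ does (w ⊑? y) ∨ does (w ⊑? b)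
      ≡⟨ sym (cong₂ _∨_ (isYes≗does (w ⊑? x)) (cong₂ _∨_ (isYes≗does (w ⊑? y)) (isYes≗does (w ⊑? b)))) ⟩
    isYes (w ⊑? x) ∨ isYes (w ⊑? y) ∨ isYes (w ⊑? b)
      ∎
    where
    open ≡-Reasoning
    b : List A
    b = takeLast k x ++ take k y

module _ {m : ℕ} {w : List (Fin m)} where

  open MonoidSolver (++-monoid (Fin m)) using (solve; _⊕_; _⊜_)

  OccursAt-++ : ∀ {i z} t → OccursAt w i z → OccursAt w i (z ++ t)
  OccursAt-++ t (x , y , refl , |x|≡i) =
    x , y ++ t , solve 4 (λ x w y t → (x ⊕ w ⊕ y) ⊕ t ⊜ x ⊕ w ⊕ y ⊕ t) refl x w y t , |x|≡i

  OccursAt⇒≤ : ∀ {i z} → OccursAt w i z → i + length w ≤ length z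
  OccursAt⇒≤ (x , y , refl , refl) = begin
    length x + length w                ≤⟨ m≤m+n _ (length y) ⟩
    length x + length w + length y     ≡⟨ +-assoc (length x) _ _ ⟩
    length x + (length w + length y)   ≡⟨ cong (length x +_) (sym (length-++ w)) ⟩
    length x + length (w ++ y)         ≡⟨ sym (length-++ x) ⟩
    length (x ++ w ++ y)               ∎
    where open ≤-Reasoning

  OccursAt-++⇒⊑ : ∀ {i} x y → OccursAt w i (x ++ y) → length x ≤ i → w ⊑ y
  OccursAt-++⇒⊑ x y (a , c , eq , refl) x≤a with d , y≡ ← ++-≡-++-≤ a (w ++ c) x y (sym eq) x≤a = d , c , y≡

  ⊑⇒OccursAt-++ : ∀ x {y} → w ⊑ y → ∃ λ i → length x ≤ i × OccursAt w i (x ++ y)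
  ⊑⇒OccursAt-++ x (a , c , refl) = length x + length a , m≤m+n _ _ ,
    x ++ a , c , solve 4 (λ x a w c → x ⊕ a ⊕ w ⊕ c ⊜ (x ⊕ a) ⊕ w ⊕ c) refl x a w c , length-++ x

module Orbit {A : Set} (f : A → A) (E : List A) (f-closed : ∀ {y} → y ∈ E → f y ∈ E)
             {x : A} (x∈E : x ∈ E) where

  orbit-∈ : ∀ j → (f ^ j) x ∈ E
  orbit-∈ zero    = x∈E
  orbit-∈ (suc j) = f-closed (orbit-∈ j)

  orbit-shift : ∀ {a b} → (f ^ a) x ≡ (f ^ b) x → ∀ t → (f ^ (t + a)) x ≡ (f ^ (t + b)) x
  orbit-shift {a} {b} fᵃx≡fᵇx t = begin
    (f ^ (t + a)) x     ≡⟨ ^-+ f t a x ⟩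
    (f ^ t) ((f ^ a) x) ≡⟨ cong (f ^ t) fᵃx≡fᵇx ⟩
    (f ^ t) ((f ^ b) x) ≡⟨ sym (^-+ f t b x) ⟩
    (f ^ (t + b)) x     ∎
    where open ≡-Reasoning

  -- Among the first |E| + 1 points two coincide (pigeonhole), and from there on the orbit
  -- is periodic, so any later point already occurred earlier.
  orbit-recurrent : ∀ j → ∃ λ i → i < suc (length E) × (f ^ i) x ≡ (f ^ j) x
  orbit-recurrent = <-rec _ recur
    where
    recur : ∀ j → (∀ {j′} → j′ < j → ∃ λ i → i < suc (length E) × (f ^ i) x ≡ (f ^ j′) x) →
            ∃ λ i → i < suc (length E) × (f ^ i) x ≡ (f ^ j) x
    recur j earlier with j <? suc (length E)
    ... | yes j<|E|+1 = j , j<|E|+1 , refl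
    ... | no  j≮|E|+1
      with a , b , a<b , same-index ← pigeonhole (n<1+n (length E)) (λ i → index (orbit-∈ (toℕ i)))
      with b≤j ← ≤-trans (toℕ≤pred[n] b) (≤-trans (n≤1+n _) (≮⇒≥ j≮|E|+1))
      with i , i< , fⁱx≡ ← earlier (≤-trans (+-monoʳ-< (j ∸ toℕ b) a<b) (≤-reflexive (m∸n+n≡m b≤j))) =
      i , i< , (begin
        (f ^ i) x                       ≡⟨ fⁱx≡ ⟩
        (f ^ (j ∸ toℕ b + toℕ a)) x     ≡⟨ orbit-shift (index-injective (setoid A) (orbit-∈ (toℕ a)) (orbit-∈ (toℕ b)) same-index) (j ∸ toℕ b) ⟩
        (f ^ (j ∸ toℕ b + toℕ b)) x     ≡⟨ cong (λ k → (f ^ k) x) (m∸n+n≡m b≤j) ⟩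
        (f ^ j) x                       ∎)
      where open ≡-Reasoning

  any-orbit? : {P : A → Set} → (∀ {y} → y ∈ E → Dec (P y)) → Dec (∃ λ j → P ((f ^ j) x))
  any-orbit? {P} P? = map′ (λ (j , _ , Pfʲx) → j , Pfʲx) later (anyUpTo? (P? ∘ orbit-∈) (suc (length E)))
    where
    later : (∃ λ j → P ((f ^ j) x)) → ∃ λ i → i < suc (length E) × P ((f ^ i) x)
    later (j , Pfʲx) with i , i< , fⁱx≡fʲx ← orbit-recurrent j = i , i< , subst P (sym fⁱx≡fʲx) Pfʲx

  all-orbit? : {P : A → Set} → (∀ {y} → y ∈ E → Dec (P y)) → Dec (∀ j → P ((f ^ j) x))
  all-orbit? {P} P? = map′ everywhere (λ ∀P {i} _ → ∀P i) (allUpTo? (P? ∘ orbit-∈) (suc (length E)))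
    where
    everywhere : (∀ {i} → i < suc (length E) → P ((f ^ i) x)) → ∀ j → P ((f ^ j) x)
    everywhere ∀P j with i , i< , fⁱx≡fʲx ← orbit-recurrent j = subst P fⁱx≡fʲx (∀P i<)

wordsUpTo : {A : Set} → List A → ℕ → List (List A)
wordsUpTo as zero    = [] ∷ []
wordsUpTo as (suc k) = [] ∷ cartesianProductWith _∷_ as (wordsUpTo as k)

∈-wordsUpTo : {A : Set} {as : List A} → (∀ a → a ∈ as) →
  ∀ {k} (z : List A) → length z ≤ k → z ∈ wordsUpTo as k
∈-wordsUpTo ∈as {zero}  []      _         = here refl
∈-wordsUpTo ∈as {suc k} []      _         = here refl
∈-wordsUpTo ∈as {suc k} (a ∷ z) (s≤s z≤k) = there (∈-cartesianProductWith⁺ _∷_ (∈as a) (∈-wordsUpTo ∈as z z≤k))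

vectorsOver : {A : Set} → List A → ∀ n → List (Vec A n)
vectorsOver E zero    = Vec.[] ∷ []
vectorsOver E (suc n) = cartesianProductWith Vec._∷_ E (vectorsOver E n)

∈-vectorsOver : {A : Set} {E : List A} {n : ℕ} (σ : Vec A n) → (∀ i → lookup σ i ∈ E) → σ ∈ vectorsOver E n
∈-vectorsOver Vec.[]       _  = here refl
∈-vectorsOver (s Vec.∷ σ) ∈E = ∈-cartesianProductWith⁺ Vec._∷_ (∈E Fin.zero) (∈-vectorsOver σ (∈E ∘ Fin.suc))

∈-bools : ∀ b → b ∈ true ∷ false ∷ []
∈-bools true  = here refl
∈-bools false = there (here refl)

module _ {n : ℕ} (φ : Fin n → List (Fin n)) where

  iter-++ : ∀ k x y → iter φ k (x ++ y) ≡ iter φ k x ++ iter φ k y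
  iter-++ zero    x y = refl
  iter-++ (suc k) x y = trans (cong (morph φ) (iter-++ k x y)) (concatMap-++ φ (iter φ k x) (iter φ k y))

  iter-[] : ∀ k → iter φ k [] ≡ []
  iter-[] zero    = refl
  iter-[] (suc k) = cong (morph φ) (iter-[] k)

  iter-suc : ∀ k z → iter φ (suc k) z ≡ iter φ k (morph φ z)
  iter-suc zero    z = refl
  iter-suc (suc k) z = cong (morph φ) (iter-suc k z)

module Sketching {A : Set} (_≟ᴬ_ : DecidableEquality A) (w : List A) where

  open Factor _≟ᴬ_

  -- The last |w| letters are stored reversed, so that both ends compose by take.
  Sketch : Set
  Sketch = List A × List A × Bool

  sketch : List A → Sketch
  sketch z = take (length w) z , take (length w) (reverse z) , isYes (w ⊑? z)

  infixr 5 _⊕_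
  _⊕_ : Sketch → Sketch → Sketch
  (p , r , b) ⊕ (p′ , r′ , b′) =
    take (length w) (p ++ p′) , take (length w) (r′ ++ r) , b ∨ b′ ∨ isYes (w ⊑? reverse r ++ p′)

  sketch-++ : ∀ x y → sketch (x ++ y) ≡ sketch x ⊕ sketch y
  sketch-++ x y = cong₂ _,_ (take-++-take x y ≤-refl ≤-refl) (cong₂ _,_
    (trans (cong (take (length w)) (reverse-++ x y)) (take-++-take (reverse y) (reverse x) ≤-refl ≤-refl))
    (⊑?-++ (length w) x y ≤-refl))

  Contains : Sketch → Set
  Contains (_ , _ , b) = T b

  contains? : ∀ s → Dec (Contains s)
  contains? (_ , _ , b) = T? b

  module Finite {as : List A} (∈as : ∀ a → a ∈ as) where

    sketches : List Sketch
    sketches = cartesianProduct (wordsUpTo as (length w)) (cartesianProduct (wordsUpTo as (length w)) (true ∷ false ∷ []))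

    ∈-sketches : ∀ {p r} b → length p ≤ length w → length r ≤ length w → (p , r , b) ∈ sketches
    ∈-sketches {p} {r} b p≤ r≤ =
      ∈-cartesianProduct⁺ (∈-wordsUpTo ∈as p p≤) (∈-cartesianProduct⁺ (∈-wordsUpTo ∈as r r≤) (∈-bools b))

    sketch-∈ : ∀ z → sketch z ∈ sketches
    sketch-∈ z = ∈-sketches _ (length-take-≤ _ z) (length-take-≤ _ (reverse z))

    ⊕-∈ : ∀ s s′ → s ⊕ s′ ∈ sketches
    ⊕-∈ (p , r , _) (p′ , r′ , _) = ∈-sketches _ (length-take-≤ _ (p ++ p′)) (length-take-≤ _ (r′ ++ r))

cyclicShift? : ∀ {m} (w u : List (Fin m)) → Dec (CyclicShift w u)
cyclicShift? w u =
  map′ (λ (i , _ , w≡) → take i u , drop i u , sym (take++drop≡id i u) , w≡) rotation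
       (anyUpTo? (λ i → ≡-dec _≟ᶠ_ w (drop i u ++ take i u)) (suc (length u)))
  where
  rotation : CyclicShift w u → ∃ λ i → i < suc (length u) × w ≡ drop i u ++ take i u
  rotation (x , y , refl , refl) =
    length x , s≤s (length-++-≤ˡ x) , cong₂ _++_ (sym (drop-length-++ x y)) (sym (take-length-++ x y))

module FixpointImage {n m : ℕ} (φ : Fin n → List (Fin n)) (a₁ : Fin n) {v : List (Fin n)}
                     (φa₁≡a₁v : φ a₁ ≡ a₁ ∷ v) (h : Fin n → List (Fin m)) where

  prefixImage : ℕ → List (Fin m)
  prefixImage k = morph h (iter φ k (a₁ ∷ []))

  blockImage : ℕ → List (Fin m)
  blockImage k = morph h (iter φ k v)

  blockImages : ℕ → ℕ → List (Fin m)
  blockImages k zero    = []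
  blockImages k (suc j) = blockImages k j ++ blockImage (k + j)

  prefixImage-suc : ∀ k → prefixImage (suc k) ≡ prefixImage k ++ blockImage k
  prefixImage-suc k = begin
    morph h (iter φ (suc k) (a₁ ∷ []))         ≡⟨ cong (morph h) (iter-suc φ k (a₁ ∷ [])) ⟩
    morph h (iter φ k (φ a₁ ++ []))            ≡⟨ cong (morph h ∘ iter φ k) (trans (++-identityʳ (φ a₁)) φa₁≡a₁v) ⟩
    morph h (iter φ k ((a₁ ∷ []) ++ v))        ≡⟨ cong (morph h) (iter-++ φ k (a₁ ∷ []) v) ⟩
    morph h (iter φ k (a₁ ∷ []) ++ iter φ k v) ≡⟨ concatMap-++ h (iter φ k (a₁ ∷ [])) (iter φ k v) ⟩
    prefixImage k ++ blockImage k              ∎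
    where open ≡-Reasoning

  prefixImage-+ : ∀ k j → prefixImage (k + j) ≡ prefixImage k ++ blockImages k j
  prefixImage-+ k zero    = trans (cong prefixImage (+-identityʳ k)) (sym (++-identityʳ (prefixImage k)))
  prefixImage-+ k (suc j) = begin
    prefixImage (k + suc j)                               ≡⟨ cong prefixImage (+-suc k j) ⟩
    prefixImage (suc (k + j))                             ≡⟨ prefixImage-suc (k + j) ⟩
    prefixImage (k + j) ++ blockImage (k + j)             ≡⟨ cong (_++ blockImage (k + j)) (prefixImage-+ k j) ⟩
    (prefixImage k ++ blockImages k j) ++ blockImage (k + j) ≡⟨ ++-assoc (prefixImage k) (blockImages k j) _ ⟩
    prefixImage k ++ blockImages k (suc j)                ∎
    where open ≡-Reasoning

  InEveryTail : List (Fin m) → Set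
  InEveryTail w = ∀ k → ∃ λ j → w ⊑ blockImages k j

  occursInfinitelyOften⇒inEveryTail : ∀ {w} → OccursInfinitelyOften φ a₁ h w → InEveryTail w
  occursInfinitelyOften⇒inEveryTail {w} io k with i , |pₖ|≤i , k′ , occ ← io (length (prefixImage k)) =
    k′ , OccursAt-++⇒⊑ (prefixImage k) (blockImages k k′) occ′ |pₖ|≤i
    where
    occ′ : OccursAt w i (prefixImage k ++ blockImages k k′)
    occ′ = subst (OccursAt w i) (trans (sym (prefixImage-+ k′ k)) (trans (cong prefixImage (+-comm k′ k)) (prefixImage-+ k k′)))
                 (OccursAt-++ (blockImages k′ k) occ)

  inEveryTail⇒occursInfinitelyOften : ∀ {w} → 0 < length w → InEveryTail w → OccursInfinitelyOften φ a₁ h w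
  inEveryTail⇒occursInfinitelyOften {w} 0<|w| tails = beyond
    where
    beyondPrefix : ∀ k → ∃ λ i → length (prefixImage k) ≤ i × OccursAtFixpointImage φ a₁ h w i
    beyondPrefix k with j , w⊑ ← tails k with i , |pₖ|≤i , occ ← ⊑⇒OccursAt-++ (prefixImage k) w⊑ =
      i , |pₖ|≤i , k + j , subst (OccursAt w i) (sym (prefixImage-+ k j)) occ

    beyond : ∀ N → ∃ λ i → i ≥ N × OccursAtFixpointImage φ a₁ h w i
    beyond zero with i , _ , occ ← beyondPrefix 0 = i , z≤n , occ
    beyond (suc N) with i , N≤i , k , occ ← beyond N with i′ , |pₖ|≤i′ , occ′ ← beyondPrefix k =
      i′ , ≤-trans (s≤s N≤i) (≤-trans (≤-trans (m<m+n i 0<|w|) (OccursAt⇒≤ occ)) |pₖ|≤i′) , occ′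

  module Decide (w : List (Fin m)) where

    open Sketching _≟ᶠ_ w
    open Finite ∈-allFin

    Sketches : Set
    Sketches = Vec Sketch n

    evalSketch : Sketches → List (Fin n) → Sketch
    evalSketch σ = foldr (λ a s → lookup σ a ⊕ s) (sketch [])

    step : Sketches → Sketches
    step σ = tabulate (evalSketch σ ∘ φ)

    levelSketches : ℕ → Sketches
    levelSketches k = tabulate (λ a → sketch (morph h (iter φ k (a ∷ []))))

    evalSketch-level : ∀ k z → evalSketch (levelSketches k) z ≡ sketch (morph h (iter φ k z))
    evalSketch-level k []      = cong (sketch ∘ morph h) (sym (iter-[] φ k))
    evalSketch-level k (a ∷ z) = begin
      lookup (levelSketches k) a ⊕ evalSketch (levelSketches k) z
        ≡⟨ cong₂ _⊕_ (lookup∘tabulate _ a) (evalSketch-level k z) ⟩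
      sketch (morph h (iter φ k (a ∷ []))) ⊕ sketch (morph h (iter φ k z))
        ≡⟨ sym (sketch-++ (morph h (iter φ k (a ∷ []))) _) ⟩
      sketch (morph h (iter φ k (a ∷ [])) ++ morph h (iter φ k z))
        ≡⟨ cong sketch (sym (concatMap-++ h (iter φ k (a ∷ [])) _)) ⟩
      sketch (morph h (iter φ k (a ∷ []) ++ iter φ k z))
        ≡⟨ cong (sketch ∘ morph h) (sym (iter-++ φ k (a ∷ []) z)) ⟩
      sketch (morph h (iter φ k (a ∷ z)))
        ∎
      where open ≡-Reasoning

    step-level : ∀ k → step (levelSketches k) ≡ levelSketches (suc k)
    step-level k = tabulate-cong λ a → trans (evalSketch-level k (φ a))
      (cong (sketch ∘ morph h) (sym (trans (iter-suc φ k (a ∷ [])) (cong (iter φ k) (++-identityʳ (φ a))))))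

    orbit-step : ∀ k → (step ^ k) (levelSketches 0) ≡ levelSketches k
    orbit-step zero    = refl
    orbit-step (suc k) = trans (cong step (orbit-step k)) (step-level k)

    advance : Sketch × Sketches → Sketch × Sketches
    advance (s , σ) = s ⊕ evalSketch σ v , step σ

    orbit-advance : ∀ k j →
      (advance ^ j) (sketch [] , levelSketches k) ≡ (sketch (blockImages k j) , levelSketches (k + j))
    orbit-advance k zero    = cong (λ i → sketch [] , levelSketches i) (sym (+-identityʳ k))
    orbit-advance k (suc j) = begin
      advance ((advance ^ j) (sketch [] , levelSketches k))
        ≡⟨ cong advance (orbit-advance k j) ⟩
      sketch (blockImages k j) ⊕ evalSketch (levelSketches (k + j)) v , step (levelSketches (k + j))
        ≡⟨ cong₂ (λ s σ → sketch (blockImages k j) ⊕ s , σ) (evalSketch-level (k + j) v)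
                 (trans (step-level (k + j)) (cong levelSketches (sym (+-suc k j)))) ⟩
      sketch (blockImages k j) ⊕ sketch (blockImage (k + j)) , levelSketches (k + suc j)
        ≡⟨ cong (_, levelSketches (k + suc j)) (sym (sketch-++ (blockImages k j) _)) ⟩
      sketch (blockImages k (suc j)) , levelSketches (k + suc j)
        ∎
      where open ≡-Reasoning

    TailContains : Sketches → Set
    TailContains σ = ∃ λ j → Contains (proj₁ ((advance ^ j) (sketch [] , σ)))

    tailContains-level : ∀ k → TailContains (levelSketches k) ⇔ (∃ λ j → w ⊑ blockImages k j)
    tailContains-level k = mk⇔
      (λ (j , c) → j , toWitness (subst (Contains ∘ proj₁) (orbit-advance k j) c))
      (λ (j , w⊑) → j , subst (Contains ∘ proj₁) (sym (orbit-advance k j)) (fromWitness w⊑))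

    vectors : List Sketches
    vectors = vectorsOver sketches n

    evalSketch-∈ : ∀ σ z → evalSketch σ z ∈ sketches
    evalSketch-∈ σ []      = sketch-∈ []
    evalSketch-∈ σ (a ∷ z) = ⊕-∈ (lookup σ a) (evalSketch σ z)

    step-∈ : ∀ σ → step σ ∈ vectors
    step-∈ σ = ∈-vectorsOver (step σ) λ a →
      subst (_∈ sketches) (sym (lookup∘tabulate (evalSketch σ ∘ φ) a)) (evalSketch-∈ σ (φ a))

    levelSketches-∈ : ∀ k → levelSketches k ∈ vectors
    levelSketches-∈ k = ∈-vectorsOver (levelSketches k) λ a →
      subst (_∈ sketches) (sym (lookup∘tabulate _ a)) (sketch-∈ _)

    advance-∈ : ∀ p → advance p ∈ cartesianProduct sketches vectors
    advance-∈ (s , σ) = ∈-cartesianProduct⁺ (⊕-∈ s (evalSketch σ v)) (step-∈ σ)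

    tailContains? : ∀ {σ} → σ ∈ vectors → Dec (TailContains σ)
    tailContains? σ∈ = Orbit.any-orbit? advance (cartesianProduct sketches vectors) (λ {p} _ → advance-∈ p)
      (∈-cartesianProduct⁺ (sketch-∈ []) σ∈) (λ {p} _ → contains? (proj₁ p))

    inEveryTail? : Dec (InEveryTail w)
    inEveryTail? = map′
      (λ everywhere k → Equivalence.to (tailContains-level k) (subst TailContains (orbit-step k) (everywhere k)))
      (λ tails k → subst TailContains (sym (orbit-step k)) (Equivalence.from (tailContains-level k) (tails k)))
      (Orbit.all-orbit? step vectors (λ {σ} _ → step-∈ σ) (levelSketches-∈ 0) tailContains?)

  occursInfinitelyOften? : ∀ w → 0 < length w → Dec (OccursInfinitelyOften φ a₁ h w)
  occursInfinitelyOften? w 0<|w| = map′ (inEveryTail⇒occursInfinitelyOften 0<|w|)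
    occursInfinitelyOften⇒inEveryTail (Decide.inEveryTail? w)

  ultPeriodicWith? : ∀ u → 0 < length u → Dec (UltPeriodicWith φ a₁ h u)
  ultPeriodicWith? u 0<|u| =
    map′ (λ all w |w|≡|u| → All.lookup all (∈-wordsUpTo ∈-allFin w (≤-reflexive |w|≡|u|)) |w|≡|u|)
         (λ periodic → All.tabulate λ {w} _ → periodic w)
         (All.all? periodicAt? (wordsUpTo (allFin m) (length u)))
    where
    periodicAt? : ∀ w → Dec (length w ≡ length u → OccursInfinitelyOften φ a₁ h w → CyclicShift w u)
    periodicAt? w with length w ≟ length u
    ... | no  |w|≢|u| = yes λ |w|≡|u| → contradiction |w|≡|u| |w|≢|u|
    ... | yes |w|≡|u| = map′ (λ p _ → p) (λ p → p |w|≡|u|)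
      (occursInfinitelyOften? w (subst (0 <_) (sym |w|≡|u|) 0<|u|) →-dec cyclicShift? w u)

corollary1 : (n m : ℕ) (φ : Fin n → List (Fin n)) (a₁ : Fin n) →
    ExtendsOver φ a₁ → (h : Fin n → List (Fin m)) (u : List (Fin m)) →
    u ≢ [] → Dec (UltPeriodicWith φ a₁ h u)
corollary1 n m φ a₁ (v , φa₁≡a₁v , _) h u u≢[] =
  FixpointImage.ultPeriodicWith? φ a₁ φa₁≡a₁v h u (≢[]⇒0<length u≢[])
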